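{- Let $A$ be the incidence matrix of the complete graph $K_4$ on vertices $a,b,c,d$, with columns indexed by the edge set $E=\{ab,ac,ad,bc,bd,cd\}$. Let $\mathbf g,\hat{\mathbf g}\in\mathbb N^6$ satisfy $A\mathbf g=A\hat{\mathbf g}$, and suppose $g(e_1)\neq\hat g(e_1)$ for some $e_1\in E$. Then there exists a cycle $(e_1,e_2,e_3,e_4)$ of length 4 in $K_4$ passing through every vertex such that $g(e_i)\neq\hat g(e_i)$ for $i=1,\dots,4$ and the signs of $g(e_i)-\hat g(e_i)$, $i=1,2,3,4$, alternate.
   Context: A vector $\mathbf g=(g(ab),\dots,g(cd))\in\mathbb N^6$ is viewed as a weighting of the edges of $K_4$, and $A\mathbf g$ is the vector of vertex degrees (sum of weights of incident edges). -}

module Defs where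

open import Data.Nat using (ℕ; _+_; _*_)
open import Data.List using (List; []; _∷_; map)
open import Data.Nat.ListAction using (sum)
open import Relation.Binary.PropositionalEquality using (_≡_; _≢_)
open import Data.Product using (_×_)

data V : Set where
  a b c d : V

data E : Set where
  ab ac ad bc bd cd : E

allEdges : List E
allEdges = ab ∷ ac ∷ ad ∷ bc ∷ bd ∷ cd ∷ []

A : V → E → ℕ
A a ab = 1
A a ac = 1
A a ad = 1
A b ab = 1
A b bc = 1
A b bd = 1
A c ac = 1
A c bc = 1
A c cd = 1
A d ad = 1
A d bd = 1
A d cd = 1
A _ _  = 0

Amul : (E → ℕ) → V → ℕ
Amul g v = sum (map (λ e → A v e * g e) allEdges)

data Joins : E → V → V → Set where
  j-ab : Joins ab a b
  j-ba : Joins ab b a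
  j-ac : Joins ac a c
  j-ca : Joins ac c a
  j-ad : Joins ad a d
  j-da : Joins ad d a
  j-bc : Joins bc b c
  j-cb : Joins bc c b
  j-bd : Joins bd b d
  j-db : Joins bd d b
  j-cd : Joins cd c d
  j-dc : Joins cd d c

record HamCycle4 (e₁ e₂ e₃ e₄ : E) : Set where
  field
    v₁ v₂ v₃ v₄ : V
    d₁₂ : v₁ ≢ v₂
    d₁₃ : v₁ ≢ v₃
    d₁₄ : v₁ ≢ v₄
    d₂₃ : v₂ ≢ v₃
    d₂₄ : v₂ ≢ v₄
    d₃₄ : v₃ ≢ v₄
    s₁ : Joins e₁ v₁ v₂
    s₂ : Joins e₂ v₂ v₃
    s₃ : Joins e₃ v₃ v₄
    s₄ : Joins e₄ v₄ v₁

module Submission where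

-- Write x(e) = g(e) − ĝ(e) ∈ ℤ for the difference of the two
-- edge weightings.  The hypothesis A g = A ĝ says that x is *balanced*: at
-- every vertex the values of x on the three incident edges sum to zero.
--   (1) In a balanced weighting of K₄ opposite (disjoint) edges carry equal
--       values: adding the equations at the endpoints of an edge e and
--       subtracting those at the endpoints of its opposite ē gives 2x(e) = 2x(ē).
--   (2) Every edge e₁ = uv lies in the two Hamiltonian 4-cycles (u v w z) and
--       (u v z w).  Their third and fourth edges are opposite to their first
--       and second ones, and their second edges vw, vz form together with e₁
--       the star of v.  We call this data the frame of e₁.
--   (3) If x(e₁) > 0 then, x summing to zero on the star of v, one of x(vw),
--       x(vz) is negative; by (1) the corresponding cycle of the frame has
--       signs +, −, +, −.
-- The theorem is (3) when ĝ(e₁) < g(e₁), and (3) for the swapped pair (ĝ, g)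
-- when g(e₁) < ĝ(e₁).

open import Defs
open import Data.Nat using (ℕ; _<_)
open import Data.Product using (Σ; _×_; ∃-syntax)
open import Data.Sum using (_⊎_)
open import Relation.Binary.PropositionalEquality using (_≡_; _≢_)

import Data.Nat as ℕ
import Data.Nat.Properties as ℕ
open import Data.Integer as ℤ using (ℤ; +_; 0ℤ)
import Data.Integer.Properties as ℤ
open import Data.Integer.Tactic.RingSolver using (solve-∀)
open import Data.Product using (_,_; map₂)
open import Function using (_∘_)
open import Data.Sum using (inj₁; inj₂)
open import Data.Empty using (⊥-elim)
open import Relation.Nullary using (yes; no)
open import Relation.Nullary.Decidable using (False; toWitnessFalse)
open import Relation.Binary.Definitions using (tri<; tri≈; tri>)
open import Relation.Binary.PropositionalEquality
  using (sym; trans; cong; cong₂; subst; module ≡-Reasoning)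

positive-difference : ∀ {i j : ℤ} → j ℤ.< i → 0ℤ ℤ.< i ℤ.- j
positive-difference j<i = ℤ.≰⇒> (λ i-j≤0 → ℤ.<⇒≱ j<i (ℤ.i-j≤0⇒i≤j i-j≤0))

difference-positive : ∀ {i j : ℤ} → 0ℤ ℤ.< i ℤ.- j → j ℤ.< i
difference-positive 0<i-j = ℤ.≰⇒> (λ i≤j → ℤ.<⇒≱ 0<i-j (ℤ.i≤j⇒i-j≤0 i≤j))

difference-negative : ∀ {i j : ℤ} → i ℤ.- j ℤ.< 0ℤ → i ℤ.< j
difference-negative i-j<0 = ℤ.≰⇒> (λ j≤i → ℤ.<⇒≱ i-j<0 (ℤ.i≤j⇒0≤j-i j≤i))

zero-sum-sign : ∀ (p q r : ℤ) → p ℤ.+ q ℤ.+ r ≡ 0ℤ → 0ℤ ℤ.< p →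
  q ℤ.< 0ℤ ⊎ r ℤ.< 0ℤ
zero-sum-sign p q r sum≡0 0<p with q ℤ.<? 0ℤ | r ℤ.<? 0ℤ
... | yes q<0 | _       = inj₁ q<0
... | no _    | yes r<0 = inj₂ r<0
... | no q≮0  | no r≮0  = ⊥-elim (ℤ.<-irrefl (sym sum≡0) 0<sum)
  where
  0<sum : 0ℤ ℤ.< p ℤ.+ q ℤ.+ r
  0<sum = ℤ.+-mono-<-≤ (ℤ.+-mono-<-≤ 0<p (ℤ.≮⇒≥ q≮0)) (ℤ.≮⇒≥ r≮0)

swap₁₂ : ∀ (p q r : ℤ) → p ℤ.+ q ℤ.+ r ≡ 0ℤ → q ℤ.+ p ℤ.+ r ≡ 0ℤ
swap₁₂ p q r = trans (cong (ℤ._+ r) (ℤ.+-comm q p))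

swap₂₃ : ∀ (p q r : ℤ) → p ℤ.+ q ℤ.+ r ≡ 0ℤ → p ℤ.+ r ℤ.+ q ≡ 0ℤ
swap₂₃ p q r = trans (reorder p q r)
  where
  reorder : ∀ (p q r : ℤ) → p ℤ.+ r ℤ.+ q ≡ p ℤ.+ q ℤ.+ r
  reorder = solve-∀

opposite-edges-agree : ∀ (uv uw uz vw vz wz : ℤ) →
  uv ℤ.+ uw ℤ.+ uz ≡ 0ℤ → uv ℤ.+ vw ℤ.+ vz ≡ 0ℤ →
  uw ℤ.+ vw ℤ.+ wz ≡ 0ℤ → uz ℤ.+ vz ℤ.+ wz ≡ 0ℤ → uv ≡ wz
opposite-edges-agree uv uw uz vw vz wz at-u at-v at-w at-z =
  ℤ.*-cancelˡ-≡ (+ 2) uv wz (begin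
    + 2 ℤ.* uv
      ≡⟨ combination uv uw uz vw vz wz ⟩
    (uv ℤ.+ uw ℤ.+ uz) ℤ.+ (uv ℤ.+ vw ℤ.+ vz)
      ℤ.- ((uw ℤ.+ vw ℤ.+ wz) ℤ.+ (uz ℤ.+ vz ℤ.+ wz)) ℤ.+ + 2 ℤ.* wz
      ≡⟨ cong₂ (λ s t → s ℤ.- t ℤ.+ + 2 ℤ.* wz)
               (cong₂ ℤ._+_ at-u at-v) (cong₂ ℤ._+_ at-w at-z) ⟩
    0ℤ ℤ.+ + 2 ℤ.* wz
      ≡⟨ ℤ.+-identityˡ (+ 2 ℤ.* wz) ⟩
    + 2 ℤ.* wz ∎)
  where
  open ≡-Reasoning
  combination : ∀ (uv uw uz vw vz wz : ℤ) → + 2 ℤ.* uv ≡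
    (uv ℤ.+ uw ℤ.+ uz) ℤ.+ (uv ℤ.+ vw ℤ.+ vz)
      ℤ.- ((uw ℤ.+ vw ℤ.+ wz) ℤ.+ (uz ℤ.+ vz ℤ.+ wz)) ℤ.+ + 2 ℤ.* wz
  combination = solve-∀

record Balanced (x : E → ℤ) : Set where
  field
    at-a : x ab ℤ.+ x ac ℤ.+ x ad ≡ 0ℤ
    at-b : x ab ℤ.+ x bc ℤ.+ x bd ≡ 0ℤ
    at-c : x ac ℤ.+ x bc ℤ.+ x cd ≡ 0ℤ
    at-d : x ad ℤ.+ x bd ℤ.+ x cd ≡ 0ℤ

opposite : E → E
opposite ab = cd
opposite ac = bd
opposite ad = bc
opposite bc = ad
opposite bd = ac
opposite cd = ab

balanced-opposite : ∀ {x} → Balanced x → ∀ e → x (opposite e) ≡ x e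
balanced-opposite {x} β = on-opposite
  where
  open Balanced β
  ab≡cd : x ab ≡ x cd
  ab≡cd = opposite-edges-agree (x ab) (x ac) (x ad) (x bc) (x bd) (x cd)
    at-a at-b at-c at-d
  ac≡bd : x ac ≡ x bd
  ac≡bd = opposite-edges-agree (x ac) (x ab) (x ad) (x bc) (x cd) (x bd)
    (swap₁₂ (x ab) (x ac) (x ad) at-a) at-c at-b (swap₂₃ (x ad) (x bd) (x cd) at-d)
  ad≡bc : x ad ≡ x bc
  ad≡bc = opposite-edges-agree (x ad) (x ab) (x ac) (x bd) (x cd) (x bc)
    (swap₁₂ (x ab) (x ad) (x ac) (swap₂₃ (x ab) (x ac) (x ad) at-a)) at-d
    (swap₂₃ (x ab) (x bc) (x bd) at-b) (swap₂₃ (x ac) (x bc) (x cd) at-c)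
  on-opposite : ∀ e → x (opposite e) ≡ x e
  on-opposite ab = sym ab≡cd
  on-opposite ac = sym ac≡bd
  on-opposite ad = sym ad≡bc
  on-opposite bc = ad≡bc
  on-opposite bd = ac≡bd
  on-opposite cd = ab≡cd

difference : (g ĝ : E → ℕ) → E → ℤ
difference g ĝ e = + g e ℤ.- + ĝ e

-- The degree of a vertex with incident edge weights m₁, m₂, m₃, in the form
-- in which Amul computes it.
degree : ℕ → ℕ → ℕ → ℕ
degree m₁ m₂ m₃ = m₁ ℕ.+ 0 ℕ.+ (m₂ ℕ.+ 0 ℕ.+ (m₃ ℕ.+ 0 ℕ.+ 0))

vertex-balance : (g ĝ : E → ℕ) (e₁ e₂ e₃ : E) →
  degree (g e₁) (g e₂) (g e₃) ≡ degree (ĝ e₁) (ĝ e₂) (ĝ e₃) →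
  difference g ĝ e₁ ℤ.+ difference g ĝ e₂ ℤ.+ difference g ĝ e₃ ≡ 0ℤ
vertex-balance g ĝ e₁ e₂ e₃ degrees = begin
  difference g ĝ e₁ ℤ.+ difference g ĝ e₂ ℤ.+ difference g ĝ e₃
    ≡⟨ regroup (+ g e₁) (+ g e₂) (+ g e₃) (+ ĝ e₁) (+ ĝ e₂) (+ ĝ e₃) ⟩
  + degree (g e₁) (g e₂) (g e₃) ℤ.- + degree (ĝ e₁) (ĝ e₂) (ĝ e₃)
    ≡⟨ ℤ.i≡j⇒i-j≡0 (cong +_ degrees) ⟩
  0ℤ ∎
  where
  open ≡-Reasoning
  regroup : ∀ (p₁ p₂ p₃ q₁ q₂ q₃ : ℤ) →
    (p₁ ℤ.- q₁) ℤ.+ (p₂ ℤ.- q₂) ℤ.+ (p₃ ℤ.- q₃) ≡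
    (p₁ ℤ.+ 0ℤ ℤ.+ (p₂ ℤ.+ 0ℤ ℤ.+ (p₃ ℤ.+ 0ℤ ℤ.+ 0ℤ)))
      ℤ.- (q₁ ℤ.+ 0ℤ ℤ.+ (q₂ ℤ.+ 0ℤ ℤ.+ (q₃ ℤ.+ 0ℤ ℤ.+ 0ℤ)))
  regroup = solve-∀

balanced-difference : (g ĝ : E → ℕ) → (∀ v → Amul g v ≡ Amul ĝ v) →
  Balanced (difference g ĝ)
balanced-difference g ĝ degrees = record
  { at-a = vertex-balance g ĝ ab ac ad (degrees a)
  ; at-b = vertex-balance g ĝ ab bc bd (degrees b)
  ; at-c = vertex-balance g ĝ ac bc cd (degrees c)
  ; at-d = vertex-balance g ĝ ad bd cd (degrees d)
  }

index : V → ℕ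
index a = 0
index b = 1
index c = 2
index d = 3

Apart : V → V → Set
Apart u v = False (index u ℕ.≟ index v)

apart : ∀ u v → Apart u v → u ≢ v
apart u v u≭v u≡v = toWitnessFalse u≭v (cong index u≡v)

-- A Hamiltonian 4-cycle through four concrete vertices, whose distinctness
-- is checked by computation.
hamCycle : ∀ {e₁ e₂ e₃ e₄} (v₁ v₂ v₃ v₄ : V)
  {1≭2 : Apart v₁ v₂} {1≭3 : Apart v₁ v₃} {1≭4 : Apart v₁ v₄}
  {2≭3 : Apart v₂ v₃} {2≭4 : Apart v₂ v₄} {3≭4 : Apart v₃ v₄} →
  Joins e₁ v₁ v₂ → Joins e₂ v₂ v₃ → Joins e₃ v₃ v₄ → Joins e₄ v₄ v₁ →
  HamCycle4 e₁ e₂ e₃ e₄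
hamCycle v₁ v₂ v₃ v₄ {1≭2} {1≭3} {1≭4} {2≭3} {2≭4} {3≭4} s₁ s₂ s₃ s₄ = record
  { v₁ = v₁ ; v₂ = v₂ ; v₃ = v₃ ; v₄ = v₄
  ; d₁₂ = apart v₁ v₂ 1≭2 ; d₁₃ = apart v₁ v₃ 1≭3 ; d₁₄ = apart v₁ v₄ 1≭4
  ; d₂₃ = apart v₂ v₃ 2≭3 ; d₂₄ = apart v₂ v₄ 2≭4 ; d₃₄ = apart v₃ v₄ 3≭4
  ; s₁ = s₁ ; s₂ = s₂ ; s₃ = s₃ ; s₄ = s₄
  }

record Frame (e₁ : E) : Set where
  field
    e₂ e₂′ : E
    cycle  : HamCycle4 e₁ e₂ (opposite e₁) (opposite e₂)
    cycle′ : HamCycle4 e₁ e₂′ (opposite e₁) (opposite e₂′)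
    star   : ∀ {x} → Balanced x → x e₁ ℤ.+ x e₂ ℤ.+ x e₂′ ≡ 0ℤ

frame : ∀ e₁ → Frame e₁
frame ab = record
  { e₂ = bc ; e₂′ = bd
  ; cycle  = hamCycle a b c d j-ab j-bc j-cd j-da
  ; cycle′ = hamCycle a b d c j-ab j-bd j-dc j-ca
  ; star   = Balanced.at-b
  }
frame ac = record
  { e₂ = bc ; e₂′ = cd
  ; cycle  = hamCycle a c b d j-ac j-cb j-bd j-da
  ; cycle′ = hamCycle a c d b j-ac j-cd j-db j-ba
  ; star   = Balanced.at-c
  }
frame ad = record
  { e₂ = bd ; e₂′ = cd
  ; cycle  = hamCycle a d b c j-ad j-db j-bc j-ca
  ; cycle′ = hamCycle a d c b j-ad j-dc j-cb j-ba
  ; star   = Balanced.at-d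
  }
frame bc = record
  { e₂ = ac ; e₂′ = cd
  ; cycle  = hamCycle b c a d j-bc j-ca j-ad j-db
  ; cycle′ = hamCycle b c d a j-bc j-cd j-da j-ab
  ; star   = λ {x} β → swap₁₂ (x ac) (x bc) (x cd) (Balanced.at-c β)
  }
frame bd = record
  { e₂ = ad ; e₂′ = cd
  ; cycle  = hamCycle b d a c j-bd j-da j-ac j-cb
  ; cycle′ = hamCycle b d c a j-bd j-dc j-ca j-ab
  ; star   = λ {x} β → swap₁₂ (x ad) (x bd) (x cd) (Balanced.at-d β)
  }
frame cd = record
  { e₂ = ad ; e₂′ = bd
  ; cycle  = hamCycle c d a b j-cd j-da j-ab j-bc
  ; cycle′ = hamCycle c d b a j-cd j-db j-ba j-ac
  ; star   = λ {x} β → swap₁₂ (x ad) (x cd) (x bd)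
                         (swap₂₃ (x ad) (x bd) (x cd) (Balanced.at-d β))
  }

negative-in-frame : ∀ {x e₁} → Balanced x → Frame e₁ → 0ℤ ℤ.< x e₁ →
  ∃[ e₂ ] (HamCycle4 e₁ e₂ (opposite e₁) (opposite e₂) × x e₂ ℤ.< 0ℤ)
negative-in-frame {x} {e₁} β
  record { e₂ = e₂ ; e₂′ = e₂′ ; cycle = cycle ; cycle′ = cycle′ ; star = star } 0<x₁
  with zero-sum-sign (x e₁) (x e₂) (x e₂′) (star β) 0<x₁
... | inj₁ x₂<0  = e₂  , cycle  , x₂<0
... | inj₂ x₂′<0 = e₂′ , cycle′ , x₂′<0

Alternating : (g ĝ : E → ℕ) → E → E → E → E → Set
Alternating g ĝ e₁ e₂ e₃ e₄ =
  ĝ e₁ < g e₁ × g e₂ < ĝ e₂ × ĝ e₃ < g e₃ × g e₄ < ĝ e₄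

alternating-cycle : (g ĝ : E → ℕ) → (∀ v → Amul g v ≡ Amul ĝ v) →
  (e₁ : E) → ĝ e₁ < g e₁ →
  ∃[ e₂ ] ∃[ e₃ ] ∃[ e₄ ] (HamCycle4 e₁ e₂ e₃ e₄ × Alternating g ĝ e₁ e₂ e₃ e₄)
alternating-cycle g ĝ degrees e₁ ĝ₁<g₁ =
  alternate (negative-in-frame β (frame e₁) 0<x₁)
  where
  x : E → ℤ
  x = difference g ĝ
  β : Balanced x
  β = balanced-difference g ĝ degrees
  0<x₁ : 0ℤ ℤ.< x e₁
  0<x₁ = positive-difference (ℤ.+<+ ĝ₁<g₁)
  below : ∀ {e} → 0ℤ ℤ.< x e → ĝ e < g e
  below 0<x = ℤ.drop‿+<+ (difference-positive 0<x)
  above : ∀ {e} → x e ℤ.< 0ℤ → g e < ĝ e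
  above x<0 = ℤ.drop‿+<+ (difference-negative x<0)
  alternate : ∃[ e₂ ] (HamCycle4 e₁ e₂ (opposite e₁) (opposite e₂) × x e₂ ℤ.< 0ℤ) →
    ∃[ e₂ ] ∃[ e₃ ] ∃[ e₄ ] (HamCycle4 e₁ e₂ e₃ e₄ × Alternating g ĝ e₁ e₂ e₃ e₄)
  alternate (e₂ , cycle , x₂<0) =
    e₂ , opposite e₁ , opposite e₂ , cycle ,
    ĝ₁<g₁ , above x₂<0 ,
    below (subst (0ℤ ℤ.<_) (sym (balanced-opposite β e₁)) 0<x₁) ,
    above (subst (ℤ._< 0ℤ) (sym (balanced-opposite β e₂)) x₂<0)

lemma3p3 : (g ĝ : E → ℕ) → (∀ v → Amul g v ≡ Amul ĝ v) → (e₁ : E) → g e₁ ≢ ĝ e₁ →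
    ∃[ e₂ ] ∃[ e₃ ] ∃[ e₄ ] (HamCycle4 e₁ e₂ e₃ e₄ ×
    ((ĝ e₁ < g e₁ × g e₂ < ĝ e₂ × ĝ e₃ < g e₃ × g e₄ < ĝ e₄)
    ⊎ (g e₁ < ĝ e₁ × ĝ e₂ < g e₂ × g e₃ < ĝ e₃ × ĝ e₄ < g e₄)))
lemma3p3 g ĝ degrees e₁ g₁≢ĝ₁ with ℕ.<-cmp (g e₁) (ĝ e₁)
... | tri≈ _ g₁≡ĝ₁ _ = ⊥-elim (g₁≢ĝ₁ g₁≡ĝ₁)
... | tri> _ _ ĝ₁<g₁ =
  map₂ (map₂ (map₂ (map₂ inj₁))) (alternating-cycle g ĝ degrees e₁ ĝ₁<g₁)
... | tri< g₁<ĝ₁ _ _ =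
  map₂ (map₂ (map₂ (map₂ inj₂))) (alternating-cycle ĝ g (sym ∘ degrees) e₁ g₁<ĝ₁)
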